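{- The structure $\mathfrak L=(\mathbb Q;<,1,(c\cdot)_{c\in\mathbb Q})$ has quantifier elimination: every first-order formula in its signature is equivalent over $\mathfrak L$ to a quantifier-free formula in the same signature.
   Context: $\mathfrak L$ is the structure with domain $\mathbb Q$ and signature $\tau_0=\{<,1\}\cup\{c\cdot\}_{c\in\mathbb Q}$, where $<$ is a binary relation symbol interpreted as the strict linear order of $\mathbb Q$, $1$ is a constant symbol interpreted as the rational number $1$, and for each $c\in\mathbb Q$, $c\cdot$ is a unary function symbol interpreted as $x\mapsto cx$. -}

module Defs where

open import Data.Nat using (ℕ; suc)
open import Data.Fin using (Fin; zero; suc)
open import Data.Rational using (ℚ; 1ℚ; _*_; _<_)
open import Data.Product using (Σ; _×_)
open import Data.Sum using (_⊎_)
open import Data.Unit using (⊤)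
open import Data.Empty using (⊥)
open import Relation.Nullary using (¬_)
open import Relation.Binary.PropositionalEquality using (_≡_)
open import Function.Bundles using (_⇔_)

data Term (n : ℕ) : Set where
  var   : Fin n → Term n
  one   : Term n
  scale : ℚ → Term n → Term n

data Formula (n : ℕ) : Set where
  tt  : Formula n
  ff  : Formula n
  _≐_ : Term n → Term n → Formula n
  _≺_ : Term n → Term n → Formula n
  ¬'_ : Formula n → Formula n
  _∧'_ : Formula n → Formula n → Formula n
  _∨'_ : Formula n → Formula n → Formula n
  _⇒'_ : Formula n → Formula n → Formula n
  ∃'  : Formula (suc n) → Formula n       -- binds variable zero
  ∀'  : Formula (suc n) → Formula n       -- binds variable zero

data QF {n : ℕ} : Formula n → Set where
  tt  : QF tt
  ff  : QF ff
  eq  : (s t : Term n) → QF (s ≐ t)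
  lt  : (s t : Term n) → QF (s ≺ t)
  neg : {φ : Formula n} → QF φ → QF (¬' φ)
  and : {φ ψ : Formula n} → QF φ → QF ψ → QF (φ ∧' ψ)
  or  : {φ ψ : Formula n} → QF φ → QF ψ → QF (φ ∨' ψ)
  imp : {φ ψ : Formula n} → QF φ → QF ψ → QF (φ ⇒' ψ)

Env : ℕ → Set
Env n = Fin n → ℚ

_∷ᵉ_ : {n : ℕ} → ℚ → Env n → Env (suc n)
(a ∷ᵉ ρ) zero    = a
(a ∷ᵉ ρ) (suc i) = ρ i

⟦_⟧ₜ : {n : ℕ} → Term n → Env n → ℚ
⟦ var i ⟧ₜ     ρ = ρ i
⟦ one ⟧ₜ       ρ = 1ℚ
⟦ scale c t ⟧ₜ ρ = c * ⟦ t ⟧ₜ ρ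

⟦_⟧ : {n : ℕ} → Formula n → Env n → Set
⟦ tt ⟧      ρ = ⊤
⟦ ff ⟧      ρ = ⊥
⟦ s ≐ t ⟧   ρ = ⟦ s ⟧ₜ ρ ≡ ⟦ t ⟧ₜ ρ
⟦ s ≺ t ⟧   ρ = ⟦ s ⟧ₜ ρ < ⟦ t ⟧ₜ ρ
⟦ ¬' φ ⟧    ρ = ¬ ⟦ φ ⟧ ρ
⟦ φ ∧' ψ ⟧  ρ = ⟦ φ ⟧ ρ × ⟦ ψ ⟧ ρ
⟦ φ ∨' ψ ⟧  ρ = ⟦ φ ⟧ ρ ⊎ ⟦ ψ ⟧ ρ
⟦ φ ⇒' ψ ⟧  ρ = ⟦ φ ⟧ ρ → ⟦ ψ ⟧ ρ
⟦ ∃' φ ⟧    ρ = Σ ℚ λ a → ⟦ φ ⟧ (a ∷ᵉ ρ)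
⟦ ∀' φ ⟧    ρ = (a : ℚ) → ⟦ φ ⟧ (a ∷ᵉ ρ)

Equivalent : {n : ℕ} → Formula n → Formula n → Set
Equivalent {n} φ ψ = (ρ : Env n) → ⟦ φ ⟧ ρ ⇔ ⟦ ψ ⟧ ρ

HasQE : Set
HasQE = (n : ℕ) (φ : Formula n) → Σ (Formula n) λ ψ → QF ψ × Equivalent φ ψ

-- Since the signature has no addition, every term in a variable x denotes either
-- c·x for some rational c or a value not depending on x.  Dividing by c therefore
-- turns each atomic formula into x < t, t < x, x = t with t free of x, or into an
-- x-free atom.  For a boolean combination l of such literals with boundary points
-- t₁, …, tₖ, a witness of ∃x l can be moved to -∞, onto some tᵢ, or just above some
-- tᵢ without changing the truth value of any literal, and each of these positions
-- can be read off without x.  Hence ∃x of a quantifier-free formula is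
-- quantifier-free, and ∀x φ is ¬∃x¬φ because quantifier-free formulas are decidable.
module Submission where

open import Defs
open import Data.Nat using (ℕ)
open import Data.Product using (Σ; _×_)

open import Data.Nat using (suc)
open import Data.Fin using (zero; suc)
open import Data.Rational
  using (ℚ; 0ℚ; 1ℚ; _+_; _*_; _-_; -_; _<_; 1/_; NonZero; _≟_; _<?_;
         positive; negative; nonPositive; nonNegative; ≢-nonZero; <-nonZero; >-nonZero)
open import Data.Rational.Properties
  using (<-irrefl; <-asym; <-trans; <-≤-trans; ≤-<-trans; <⇒≤; ≮⇒≥; <-cmp; <-dense;
         *-identityˡ; *-assoc; *-comm; *-zeroˡ; *-zeroʳ; *-inverseˡ; *-inverseʳ;
         *-cancelˡ-<-nonNeg; *-cancelˡ-<-nonPos;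
         *-monoʳ-<-pos; *-monoʳ-<-neg; *-monoˡ-<-pos; *-monoˡ-<-neg;
         *-monoʳ-≤-nonPos; *-monoʳ-≤-nonNeg; +-monoʳ-<; +-identityʳ; negative⁻¹; positive⁻¹)
open import Data.Product using (_,_)
open import Data.Product.Function.NonDependent.Propositional using (_×-⇔_)
open import Data.Product.Function.Dependent.Propositional using (Σ-⇔)
open import Data.Sum using (_⊎_; inj₁; inj₂)
open import Data.Sum.Function.Propositional using (_⊎-⇔_)
open import Data.Empty using (⊥-elim)
open import Data.List using (List; []; _∷_; _++_; [_])
open import Data.List.Relation.Unary.All as All using (All; []; _∷_; universal)
open import Data.List.Relation.Unary.All.Properties using (++⁻ˡ; ++⁻ʳ)
open import Data.List.Relation.Unary.Any as Any using (Any; here; there; satisfied)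
open import Data.List.Membership.Propositional using (_∈_; lose)
open import Function.Base using (_∘_)
open import Function.Bundles using (_⇔_; mk⇔; Equivalence)
open import Function.Construct.Identity using (↠-id)
open import Function.Properties.Equivalence using (⇔-isEquivalence)
open import Function.Related.TypeIsomorphisms using (→-cong-⇔; ¬-cong-⇔)
open import Level using (0ℓ)
open import Relation.Binary.Definitions using (tri<; tri≈; tri>)
open import Relation.Binary.PropositionalEquality
  using (_≡_; _≢_; refl; sym; trans; cong; cong₂; subst; module ≡-Reasoning)
open import Relation.Binary.Structures using (IsEquivalence)
open import Relation.Nullary using (¬_; Dec; yes; no)
import Relation.Nullary.Decidable as Decidable
open import Relation.Nullary.Decidable using (_×-dec_; _⊎-dec_; _→-dec_; ¬?; decidable-stable)

open Equivalence using (to; from)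
open IsEquivalence (⇔-isEquivalence {0ℓ})
  using () renaming (refl to ⇔-refl; sym to ⇔-sym; trans to ⇔-trans; reflexive to ≡⇒⇔)

private
  variable
    n : ℕ

-- Order structure of finitely many rationals

p-1<p : ∀ p → p - 1ℚ < p
p-1<p p = subst (p - 1ℚ <_) (+-identityʳ p) (+-monoʳ-< p (negative⁻¹ (- 1ℚ)))

p<p+1 : ∀ p → p < p + 1ℚ
p<p+1 p = subst (_< p + 1ℚ) (+-identityʳ p) (+-monoʳ-< p (positive⁻¹ 1ℚ))

module _ {A : Set} (f : A → ℚ) where

  below-all : (xs : List A) → Σ ℚ λ b → All (λ x → b < f x) xs
  below-all [] = 0ℚ , []
  below-all (x ∷ xs) with below-all xs
  ... | b , b<xs with b <? f x
  ...   | yes b<x = b , b<x ∷ b<xs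
  ...   | no b≮x = f x - 1ℚ , p-1<p (f x) ∷
    All.map (λ b<y → <-trans (p-1<p (f x)) (≤-<-trans (≮⇒≥ b≮x) b<y)) b<xs

  gap-above : (s : ℚ) (xs : List A) → Σ ℚ λ b → s < b × All (λ x → s < f x → b < f x) xs
  gap-above s [] = s + 1ℚ , p<p+1 s , []
  gap-above s (x ∷ xs) with gap-above s xs
  ... | b , s<b , gap with s <? f x
  ...   | no s≮x = b , s<b , (⊥-elim ∘ s≮x) ∷ gap
  ...   | yes s<x with b <? f x
  ...     | yes b<x = b , s<b , (λ _ → b<x) ∷ gap
  ...     | no b≮x with <-dense s<x
  ...       | c , s<c , c<x = c , s<c , (λ _ → c<x) ∷
    All.map (λ h s<y → <-trans c<x (≤-<-trans (≮⇒≥ b≮x) (h s<y))) gap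

  data Position (a : ℚ) (xs : List A) : Set where
    before : All (λ x → a < f x) xs → Position a xs
    on     : Any (λ x → a ≡ f x) xs → Position a xs
    after  : (s : A) → s ∈ xs → f s < a → All (λ x → f s < f x → a < f x) xs → Position a xs

  locate : (a : ℚ) (xs : List A) → Position a xs
  locate a [] = before []
  locate a (x ∷ xs) with locate a xs | <-cmp a (f x)
  ... | on a∈xs             | _            = on (there a∈xs)
  ... | _                  | tri≈ _ a≡x _ = on (here a≡x)
  ... | before a<xs        | tri< a<x _ _ = before (a<x ∷ a<xs)
  ... | before a<xs        | tri> _ _ x<a =
    after x (here refl) x<a (⊥-elim ∘ <-irrefl refl ∷ All.map (λ a<y _ → a<y) a<xs)
  ... | after s s∈ s<a gap | tri< a<x _ _ = after s (there s∈) s<a ((λ _ → a<x) ∷ gap)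
  ... | after s s∈ s<a gap | tri> _ _ x<a with f s <? f x
  ...   | yes s<x =
    after x (here refl) x<a (⊥-elim ∘ <-irrefl refl ∷ All.map (λ h x<y → h (<-trans s<x x<y)) gap)
  ...   | no s≮x  = after s (there s∈) s<a ((⊥-elim ∘ s≮x) ∷ gap)

-- Solving linear comparisons over ℚ

module _ (c : ℚ) .{{_ : NonZero c}} where

  c*[1/c*q]≡q : ∀ q → c * (1/ c * q) ≡ q
  c*[1/c*q]≡q q = begin
    c * (1/ c * q) ≡⟨ *-assoc c (1/ c) q ⟨
    c * 1/ c * q   ≡⟨ cong (_* q) (*-inverseʳ c) ⟩
    1ℚ * q         ≡⟨ *-identityˡ q ⟩
    q              ∎
    where open ≡-Reasoning

  1/c*[c*p]≡p : ∀ p → 1/ c * (c * p) ≡ p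
  1/c*[c*p]≡p p = begin
    1/ c * (c * p) ≡⟨ *-assoc (1/ c) c p ⟨
    1/ c * c * p   ≡⟨ cong (_* p) (*-inverseˡ c) ⟩
    1ℚ * p         ≡⟨ *-identityˡ p ⟩
    p              ∎
    where open ≡-Reasoning

  c*p≡q⇔p≡1/c*q : ∀ {p q} → (c * p ≡ q) ⇔ (p ≡ 1/ c * q)
  c*p≡q⇔p≡1/c*q {p} {q} = mk⇔
    (λ c*p≡q → trans (sym (1/c*[c*p]≡p p)) (cong (1/ c *_) c*p≡q))
    (λ p≡1/c*q → trans (cong (c *_) p≡1/c*q) (c*[1/c*q]≡q q))

  *-cancelˡ-≡ : ∀ {p q} → c * p ≡ c * q → p ≡ q
  *-cancelˡ-≡ {p} {q} c*p≡c*q = trans (to c*p≡q⇔p≡1/c*q c*p≡c*q) (1/c*[c*p]≡p q)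

  c*p<q⇔c*p<c*[1/c*q] : ∀ {p q} → (c * p < q) ⇔ (c * p < c * (1/ c * q))
  c*p<q⇔c*p<c*[1/c*q] {p} {q} = ≡⇒⇔ (cong (c * p <_) (sym (c*[1/c*q]≡q q)))

  q<c*p⇔c*[1/c*q]<c*p : ∀ {p q} → (q < c * p) ⇔ (c * (1/ c * q) < c * p)
  q<c*p⇔c*[1/c*q]<c*p {p} {q} = ≡⇒⇔ (cong (_< c * p) (sym (c*[1/c*q]≡q q)))

c*p<c*q⇔p<q : ∀ {c p q} → 0ℚ < c → (c * p < c * q) ⇔ (p < q)
c*p<c*q⇔p<q {c} 0<c = mk⇔
  (*-cancelˡ-<-nonNeg c {{nonNegative (<⇒≤ 0<c)}})
  (*-monoʳ-<-pos c {{positive 0<c}})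

c*p<c*q⇔q<p : ∀ {c p q} → c < 0ℚ → (c * p < c * q) ⇔ (q < p)
c*p<c*q⇔q<p {c} c<0 = mk⇔
  (*-cancelˡ-<-nonPos c {{nonPositive (<⇒≤ c<0)}})
  (*-monoʳ-<-neg c {{negative c<0}})

c*a<d*a⇔0<a : ∀ {c d a} → c < d → (c * a < d * a) ⇔ (0ℚ < a)
c*a<d*a⇔0<a {c} {d} {a} c<d = mk⇔
  (λ ca<da → decidable-stable (0ℚ <? a) λ 0≮a →
    <-irrefl refl (<-≤-trans ca<da (*-monoʳ-≤-nonPos a {{nonPositive (≮⇒≥ 0≮a)}} (<⇒≤ c<d))))
  (λ 0<a → *-monoˡ-<-pos a {{positive 0<a}} c<d)

c*a<d*a⇔a<0 : ∀ {c d a} → d < c → (c * a < d * a) ⇔ (a < 0ℚ)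
c*a<d*a⇔a<0 {c} {d} {a} d<c = mk⇔
  (λ ca<da → decidable-stable (a <? 0ℚ) λ a≮0 →
    <-irrefl refl (<-≤-trans ca<da (*-monoʳ-≤-nonNeg a {{nonNegative (≮⇒≥ a≮0)}} (<⇒≤ d<c))))
  (λ a<0 → *-monoˡ-<-neg a {{negative a<0}} d<c)

c*a≡d*a⇔a≡0 : ∀ {c d a} → c ≢ d → (c * a ≡ d * a) ⇔ (a ≡ 0ℚ)
c*a≡d*a⇔a≡0 {c} {d} {a} c≢d = mk⇔
  (λ ca≡da → decidable-stable (a ≟ 0ℚ) λ a≢0 →
    c≢d (*-cancelˡ-≡ a {{≢-nonZero a≢0}} (trans (*-comm a c) (trans ca≡da (*-comm d a)))))
  (λ { refl → trans (*-zeroʳ c) (sym (*-zeroʳ d)) })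

-- Formulas solved for the variable x

infix  8 x<_ _<x x≐_
infix  7 ¬ˢ_
infixr 6 _∧ˢ_ _∨ˢ_ _⇒ˢ_

data Solved (n : ℕ) : Set where
  free           : (φ : Formula n) → QF φ → Solved n
  x<_ _<x x≐_    : Term n → Solved n
  ¬ˢ_            : Solved n → Solved n
  _∧ˢ_ _∨ˢ_ _⇒ˢ_ : Solved n → Solved n → Solved n

⟦_⟧ˢ : Solved n → ℚ → Env n → Set
⟦ free φ _ ⟧ˢ a ρ = ⟦ φ ⟧ ρ
⟦ x< t ⟧ˢ     a ρ = a < ⟦ t ⟧ₜ ρ
⟦ t <x ⟧ˢ     a ρ = ⟦ t ⟧ₜ ρ < a
⟦ x≐ t ⟧ˢ     a ρ = a ≡ ⟦ t ⟧ₜ ρ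
⟦ ¬ˢ l ⟧ˢ     a ρ = ¬ ⟦ l ⟧ˢ a ρ
⟦ l ∧ˢ m ⟧ˢ   a ρ = ⟦ l ⟧ˢ a ρ × ⟦ m ⟧ˢ a ρ
⟦ l ∨ˢ m ⟧ˢ   a ρ = ⟦ l ⟧ˢ a ρ ⊎ ⟦ m ⟧ˢ a ρ
⟦ l ⇒ˢ m ⟧ˢ   a ρ = ⟦ l ⟧ˢ a ρ → ⟦ m ⟧ˢ a ρ

boundary : Solved n → List (Term n)
boundary (free _ _) = []
boundary (x< t)     = [ t ]
boundary (t <x)     = [ t ]
boundary (x≐ t)     = [ t ]
boundary (¬ˢ l)     = boundary l
boundary (l ∧ˢ m)   = boundary l ++ boundary m
boundary (l ∨ˢ m)   = boundary l ++ boundary m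
boundary (l ⇒ˢ m)   = boundary l ++ boundary m

-- x-free formulas standing for the literals x < t, t < x and x = t
record Reading (n : ℕ) : Set where
  field
    below above equal : Term n → Formula n

open Reading

read : Reading n → Solved n → Formula n
read R (free φ _) = φ
read R (x< t)     = below R t
read R (t <x)     = above R t
read R (x≐ t)     = equal R t
read R (¬ˢ l)     = ¬' read R l
read R (l ∧ˢ m)   = read R l ∧' read R m
read R (l ∨ˢ m)   = read R l ∨' read R m
read R (l ⇒ˢ m)   = read R l ⇒' read R m

QF-Reading : Reading n → Set
QF-Reading R = ∀ t → QF (below R t) × QF (above R t) × QF (equal R t)

read-QF : {R : Reading n} → QF-Reading R → (l : Solved n) → QF (read R l)
read-QF qR (free φ q) = q
read-QF qR (x< t)     = let (q , _ , _) = qR t in q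
read-QF qR (t <x)     = let (_ , q , _) = qR t in q
read-QF qR (x≐ t)     = let (_ , _ , q) = qR t in q
read-QF qR (¬ˢ l)     = neg (read-QF qR l)
read-QF qR (l ∧ˢ m)   = and (read-QF qR l) (read-QF qR m)
read-QF qR (l ∨ˢ m)   = or (read-QF qR l) (read-QF qR m)
read-QF qR (l ⇒ˢ m)   = imp (read-QF qR l) (read-QF qR m)

record Agrees (R : Reading n) (a : ℚ) (ρ : Env n) (t : Term n) : Set where
  constructor agrees
  field
    below-agrees : ⟦ below R t ⟧ ρ ⇔ (a < ⟦ t ⟧ₜ ρ)
    above-agrees : ⟦ above R t ⟧ ρ ⇔ (⟦ t ⟧ₜ ρ < a)
    equal-agrees : ⟦ equal R t ⟧ ρ ⇔ (a ≡ ⟦ t ⟧ₜ ρ)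

read-correct : ∀ R a (ρ : Env n) l →
  All (Agrees R a ρ) (boundary l) → ⟦ read R l ⟧ ρ ⇔ ⟦ l ⟧ˢ a ρ
read-correct R a ρ (free φ _) _                = ⇔-refl
read-correct R a ρ (x< t) (agrees e _ _ ∷ [])  = e
read-correct R a ρ (t <x) (agrees _ e _ ∷ [])  = e
read-correct R a ρ (x≐ t) (agrees _ _ e ∷ [])  = e
read-correct R a ρ (¬ˢ l) ag                   = ¬-cong-⇔ (read-correct R a ρ l ag)
read-correct R a ρ (l ∧ˢ m) ag =
  read-correct R a ρ l (++⁻ˡ (boundary l) ag) ×-⇔ read-correct R a ρ m (++⁻ʳ (boundary l) ag)
read-correct R a ρ (l ∨ˢ m) ag =
  read-correct R a ρ l (++⁻ˡ (boundary l) ag) ⊎-⇔ read-correct R a ρ m (++⁻ʳ (boundary l) ag)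
read-correct R a ρ (l ⇒ˢ m) ag =
  →-cong-⇔ (read-correct R a ρ l (++⁻ˡ (boundary l) ag))
           (read-correct R a ρ m (++⁻ʳ (boundary l) ag))

at : Term n → Reading n
at s = record { below = s ≺_ ; above = _≺ s ; equal = s ≐_ }

-∞ : Reading n
-∞ = record { below = λ _ → tt ; above = λ _ → ff ; equal = λ _ → ff }

-- Reads the literals at any point a > s with no boundary point in (s, a].
_⁺ : Term n → Reading n
s ⁺ = record { below = s ≺_ ; above = λ t → ¬' (s ≺ t) ; equal = λ _ → ff }

at-QF : (s : Term n) → QF-Reading (at s)
at-QF s t = lt s t , lt t s , eq s t

-∞-QF : QF-Reading {n} -∞
-∞-QF t = tt , ff , ff

⁺-QF : (s : Term n) → QF-Reading (s ⁺)
⁺-QF s t = lt s t , neg (lt s t) , ff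

module _ (ρ : Env n) where

  at-agrees : ∀ s t → Agrees (at s) (⟦ s ⟧ₜ ρ) ρ t
  at-agrees s t = agrees ⇔-refl ⇔-refl ⇔-refl

  -∞-agrees : ∀ {a t} → a < ⟦ t ⟧ₜ ρ → Agrees -∞ a ρ t
  -∞-agrees a<t = agrees
    (mk⇔ (λ _ → a<t) _)
    (mk⇔ ⊥-elim (λ t<a → <-asym a<t t<a))
    (mk⇔ ⊥-elim (λ a≡t → <-irrefl a≡t a<t))

  ⁺-agrees : ∀ {s a t} → ⟦ s ⟧ₜ ρ < a → (⟦ s ⟧ₜ ρ < ⟦ t ⟧ₜ ρ → a < ⟦ t ⟧ₜ ρ) →
             Agrees (s ⁺) a ρ t
  ⁺-agrees {s} {a} {t} s<a gap with ⟦ s ⟧ₜ ρ <? ⟦ t ⟧ₜ ρ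
  ... | yes s<t = agrees
    (mk⇔ (λ _ → gap s<t) (λ _ → s<t))
    (mk⇔ (λ s≮t → ⊥-elim (s≮t s<t)) (λ t<a → ⊥-elim (<-asym t<a (gap s<t))))
    (mk⇔ ⊥-elim (λ a≡t → <-irrefl a≡t (gap s<t)))
  ... | no s≮t = agrees
    (mk⇔ (λ s<t → ⊥-elim (s≮t s<t)) (λ a<t → ⊥-elim (<-asym a<t t<a)))
    (mk⇔ (λ _ → t<a) (λ _ → s≮t))
    (mk⇔ ⊥-elim (λ a≡t → <-irrefl (sym a≡t) t<a))
    where t<a = ≤-<-trans (≮⇒≥ s≮t) s<a

-- Eliminating ∃x from a solved formula

⋁ : List (Term n) → (Term n → Formula n) → Formula n
⋁ []       φ = ff
⋁ (t ∷ ts) φ = φ t ∨' ⋁ ts φ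

⋁-QF : ∀ ts {φ : Term n → Formula n} → (∀ t → QF (φ t)) → QF (⋁ ts φ)
⋁-QF []       qφ = ff
⋁-QF (t ∷ ts) qφ = or (qφ t) (⋁-QF ts qφ)

⋁⇔Any : ∀ ts (φ : Term n → Formula n) ρ → ⟦ ⋁ ts φ ⟧ ρ ⇔ Any (λ t → ⟦ φ t ⟧ ρ) ts
⋁⇔Any []       φ ρ = mk⇔ (λ ()) (λ ())
⋁⇔Any (t ∷ ts) φ ρ = mk⇔
  (λ { (inj₁ φt) → here φt ; (inj₂ φts) → there (to (⋁⇔Any ts φ ρ) φts) })
  (λ { (here φt) → inj₁ φt ; (there φts) → inj₂ (from (⋁⇔Any ts φ ρ) φts) })

eliminate : Solved n → Formula n
eliminate l =
  read -∞ l ∨' (⋁ (boundary l) (λ t → read (at t) l) ∨' ⋁ (boundary l) (λ t → read (t ⁺) l))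

eliminate-QF : (l : Solved n) → QF (eliminate l)
eliminate-QF l = or (read-QF -∞-QF l)
  (or (⋁-QF (boundary l) λ t → read-QF (at-QF t) l)
      (⋁-QF (boundary l) λ t → read-QF (⁺-QF t) l))

eliminate-correct : (ρ : Env n) (l : Solved n) → (Σ ℚ λ a → ⟦ l ⟧ˢ a ρ) ⇔ ⟦ eliminate l ⟧ ρ
eliminate-correct {n} ρ l = mk⇔ forward backward
  where
  value : Term n → ℚ
  value t = ⟦ t ⟧ₜ ρ

  B : List (Term n)
  B = boundary l

  read-at : ∀ s → ⟦ read (at s) l ⟧ ρ ⇔ ⟦ l ⟧ˢ (value s) ρ
  read-at s = read-correct (at s) (value s) ρ l (universal (at-agrees ρ s) B)

  forward : (Σ ℚ λ a → ⟦ l ⟧ˢ a ρ) → ⟦ eliminate l ⟧ ρ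
  forward (a , la) with locate value a B
  ... | before a<B = inj₁ (from (read-correct -∞ a ρ l (All.map (-∞-agrees ρ) a<B)) la)
  ... | on a∈B = inj₂ (inj₁ (from (⋁⇔Any B _ ρ)
          (Any.map (λ {t} a≡t → from (read-at t) (subst (λ b → ⟦ l ⟧ˢ b ρ) a≡t la)) a∈B)))
  ... | after s s∈B s<a gap = inj₂ (inj₂ (from (⋁⇔Any B _ ρ)
          (lose s∈B (from (read-correct (s ⁺) a ρ l (All.map (⁺-agrees ρ s<a) gap)) la))))

  backward : ⟦ eliminate l ⟧ ρ → Σ ℚ λ a → ⟦ l ⟧ˢ a ρ
  backward (inj₁ l-∞) with below-all value B
  ... | b , b<B = b , to (read-correct -∞ b ρ l (All.map (-∞-agrees ρ) b<B)) l-∞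
  backward (inj₂ (inj₁ l-at)) with satisfied (to (⋁⇔Any B _ ρ) l-at)
  ... | s , l-s = value s , to (read-at s) l-s
  backward (inj₂ (inj₂ l-⁺)) with satisfied (to (⋁⇔Any B _ ρ) l-⁺)
  ... | s , l-s⁺ with gap-above value (value s) B
  ...   | b , s<b , gap =
    b , to (read-correct (s ⁺) b ρ l (All.map (⁺-agrees ρ s<b) gap)) l-s⁺

-- Solving atomic formulas for x

infix 9 _·x

data Linear (n : ℕ) : Set where
  _·x   : ℚ → Linear n
  const : Term n → Linear n

⟦_⟧ˡ : Linear n → ℚ → Env n → ℚ
⟦ c ·x ⟧ˡ    a ρ = c * a
⟦ const u ⟧ˡ a ρ = ⟦ u ⟧ₜ ρ

scaleˡ : ℚ → Linear n → Linear n
scaleˡ c (d ·x)    = (c * d) ·x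
scaleˡ c (const u) = const (scale c u)

scaleˡ-correct : ∀ c (e : Linear n) a ρ → c * ⟦ e ⟧ˡ a ρ ≡ ⟦ scaleˡ c e ⟧ˡ a ρ
scaleˡ-correct c (d ·x)    a ρ = sym (*-assoc c d a)
scaleˡ-correct c (const u) a ρ = refl

linearise : Term (suc n) → Linear n
linearise (var zero)    = 1ℚ ·x
linearise (var (suc i)) = const (var i)
linearise one           = const one
linearise (scale c t)   = scaleˡ c (linearise t)

linearise-correct : ∀ (t : Term (suc n)) a ρ → ⟦ t ⟧ₜ (a ∷ᵉ ρ) ≡ ⟦ linearise t ⟧ˡ a ρ
linearise-correct (var zero)    a ρ = sym (*-identityˡ a)
linearise-correct (var (suc i)) a ρ = refl
linearise-correct one           a ρ = refl
linearise-correct (scale c t)   a ρ =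
  trans (cong (c *_) (linearise-correct t a ρ)) (scaleˡ-correct c (linearise t) a ρ)

Solvable : (ℚ → Env n → Set) → Set
Solvable {n} P = Σ (Solved n) λ l → ∀ a ρ → P a ρ ⇔ ⟦ l ⟧ˢ a ρ

Solvable-resp-⇔ : {P Q : ℚ → Env n → Set} →
  (∀ a ρ → P a ρ ⇔ Q a ρ) → Solvable Q → Solvable P
Solvable-resp-⇔ P⇔Q (l , Q⇔l) = l , λ a ρ → ⇔-trans (P⇔Q a ρ) (Q⇔l a ρ)

-- The term 0·1 denotes 0ℚ definitionally.
0ₜ : Term n
0ₜ = scale 0ℚ one

solve< : (e f : Linear n) → Solvable (λ a ρ → ⟦ e ⟧ˡ a ρ < ⟦ f ⟧ˡ a ρ)
solve< (const u) (const v) = free (u ≺ v) (lt u v) , λ _ _ → ⇔-refl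
solve< (c ·x) (const v) with <-cmp c 0ℚ
... | tri< c<0 _ _ = scale ((1/ c) {{<-nonZero c<0}}) v <x ,
  λ _ _ → ⇔-trans (c*p<q⇔c*p<c*[1/c*q] c {{<-nonZero c<0}}) (c*p<c*q⇔q<p c<0)
... | tri≈ _ refl _ = free (0ₜ ≺ v) (lt 0ₜ v) , λ a _ → ≡⇒⇔ (cong (_< _) (*-zeroˡ a))
... | tri> _ _ 0<c = x< scale ((1/ c) {{>-nonZero 0<c}}) v ,
  λ _ _ → ⇔-trans (c*p<q⇔c*p<c*[1/c*q] c {{>-nonZero 0<c}}) (c*p<c*q⇔p<q 0<c)
solve< (const u) (c ·x) with <-cmp c 0ℚ
... | tri< c<0 _ _ = x< scale ((1/ c) {{<-nonZero c<0}}) u ,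
  λ _ _ → ⇔-trans (q<c*p⇔c*[1/c*q]<c*p c {{<-nonZero c<0}}) (c*p<c*q⇔q<p c<0)
... | tri≈ _ refl _ = free (u ≺ 0ₜ) (lt u 0ₜ) , λ a _ → ≡⇒⇔ (cong (_ <_) (*-zeroˡ a))
... | tri> _ _ 0<c = scale ((1/ c) {{>-nonZero 0<c}}) u <x ,
  λ _ _ → ⇔-trans (q<c*p⇔c*[1/c*q]<c*p c {{>-nonZero 0<c}}) (c*p<c*q⇔p<q 0<c)
solve< (c ·x) (d ·x) with <-cmp c d
... | tri< c<d _ _ = 0ₜ <x , λ _ _ → c*a<d*a⇔0<a c<d
... | tri≈ _ refl _ = free ff ff , λ _ _ → mk⇔ (<-irrefl refl) ⊥-elim
... | tri> _ _ d<c = x< 0ₜ , λ _ _ → c*a<d*a⇔a<0 d<c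

solve≐ : (e f : Linear n) → Solvable (λ a ρ → ⟦ e ⟧ˡ a ρ ≡ ⟦ f ⟧ˡ a ρ)
solve≐ (const u) (const v) = free (u ≐ v) (eq u v) , λ _ _ → ⇔-refl
solve≐ (c ·x) (const v) with c ≟ 0ℚ
... | yes refl = free (0ₜ ≐ v) (eq 0ₜ v) , λ a _ → ≡⇒⇔ (cong (_≡ _) (*-zeroˡ a))
... | no c≢0 = x≐ scale ((1/ c) {{≢-nonZero c≢0}}) v ,
  λ _ _ → c*p≡q⇔p≡1/c*q c {{≢-nonZero c≢0}}
solve≐ (const u) (c ·x) = Solvable-resp-⇔ (λ _ _ → mk⇔ sym sym) (solve≐ (c ·x) (const u))
solve≐ (c ·x) (d ·x) with c ≟ d
... | yes refl = free tt tt , λ _ _ → mk⇔ _ (λ _ → refl)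
... | no c≢d = x≐ 0ₜ , λ _ _ → c*a≡d*a⇔a≡0 c≢d

solve : {φ : Formula (suc n)} → QF φ → Solvable (λ a ρ → ⟦ φ ⟧ (a ∷ᵉ ρ))
solve tt = free tt tt , λ _ _ → ⇔-refl
solve ff = free ff ff , λ _ _ → ⇔-refl
solve (eq s t) = Solvable-resp-⇔
  (λ a ρ → ≡⇒⇔ (cong₂ _≡_ (linearise-correct s a ρ) (linearise-correct t a ρ)))
  (solve≐ (linearise s) (linearise t))
solve (lt s t) = Solvable-resp-⇔
  (λ a ρ → ≡⇒⇔ (cong₂ _<_ (linearise-correct s a ρ) (linearise-correct t a ρ)))
  (solve< (linearise s) (linearise t))
solve (neg q) with solve q
... | l , e = ¬ˢ l , λ a ρ → ¬-cong-⇔ (e a ρ)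
solve (and q r) with solve q | solve r
... | l , e | m , f = l ∧ˢ m , λ a ρ → e a ρ ×-⇔ f a ρ
solve (or q r) with solve q | solve r
... | l , e | m , f = l ∨ˢ m , λ a ρ → e a ρ ⊎-⇔ f a ρ
solve (imp q r) with solve q | solve r
... | l , e | m , f = l ⇒ˢ m , λ a ρ → →-cong-⇔ (e a ρ) (f a ρ)

∃-eliminate : {φ : Formula (suc n)} → QF φ →
  Σ (Formula n) λ ψ → QF ψ × (∀ ρ → (Σ ℚ λ a → ⟦ φ ⟧ (a ∷ᵉ ρ)) ⇔ ⟦ ψ ⟧ ρ)
∃-eliminate q with solve q
... | l , φ⇔l = eliminate l , eliminate-QF l ,
  λ ρ → ⇔-trans (Σ-⇔ (↠-id ℚ) (φ⇔l _ ρ)) (eliminate-correct ρ l)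

QF-dec : {φ : Formula n} → QF φ → (ρ : Env n) → Dec (⟦ φ ⟧ ρ)
QF-dec tt        ρ = yes _
QF-dec ff        ρ = no λ ()
QF-dec (eq s t)  ρ = ⟦ s ⟧ₜ ρ ≟ ⟦ t ⟧ₜ ρ
QF-dec (lt s t)  ρ = ⟦ s ⟧ₜ ρ <? ⟦ t ⟧ₜ ρ
QF-dec (neg q)   ρ = ¬? (QF-dec q ρ)
QF-dec (and q r) ρ = QF-dec q ρ ×-dec QF-dec r ρ
QF-dec (or q r)  ρ = QF-dec q ρ ⊎-dec QF-dec r ρ
QF-dec (imp q r) ρ = QF-dec q ρ →-dec QF-dec r ρ

∀⇔¬∃¬ : {A : Set} {P : A → Set} → (∀ a → Dec (P a)) → (∀ a → P a) ⇔ (¬ Σ A λ a → ¬ P a)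
∀⇔¬∃¬ P? = mk⇔
  (λ ∀P (a , ¬Pa) → ¬Pa (∀P a))
  (λ ¬∃¬P a → decidable-stable (P? a) λ ¬Pa → ¬∃¬P (a , ¬Pa))

QE : Formula n → Set
QE {n} φ = Σ (Formula n) λ ψ → QF ψ × Equivalent φ ψ

qe : (φ : Formula n) → QE φ
qe tt      = tt , tt , λ _ → ⇔-refl
qe ff      = ff , ff , λ _ → ⇔-refl
qe (s ≐ t) = s ≐ t , eq s t , λ _ → ⇔-refl
qe (s ≺ t) = s ≺ t , lt s t , λ _ → ⇔-refl
qe (¬' φ) with qe φ
... | ψ , qψ , φ⇔ψ = ¬' ψ , neg qψ , λ ρ → ¬-cong-⇔ (φ⇔ψ ρ)
qe (φ ∧' φ′) with qe φ | qe φ′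
... | ψ , qψ , φ⇔ψ | ψ′ , qψ′ , φ′⇔ψ′ =
  ψ ∧' ψ′ , and qψ qψ′ , λ ρ → φ⇔ψ ρ ×-⇔ φ′⇔ψ′ ρ
qe (φ ∨' φ′) with qe φ | qe φ′
... | ψ , qψ , φ⇔ψ | ψ′ , qψ′ , φ′⇔ψ′ =
  ψ ∨' ψ′ , or qψ qψ′ , λ ρ → φ⇔ψ ρ ⊎-⇔ φ′⇔ψ′ ρ
qe (φ ⇒' φ′) with qe φ | qe φ′
... | ψ , qψ , φ⇔ψ | ψ′ , qψ′ , φ′⇔ψ′ =
  ψ ⇒' ψ′ , imp qψ qψ′ , λ ρ → →-cong-⇔ (φ⇔ψ ρ) (φ′⇔ψ′ ρ)
qe (∃' φ) with qe φ
... | ψ , qψ , φ⇔ψ with ∃-eliminate qψ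
...   | χ , qχ , ∃ψ⇔χ = χ , qχ , λ ρ → ⇔-trans (Σ-⇔ (↠-id ℚ) (φ⇔ψ _)) (∃ψ⇔χ ρ)
qe (∀' φ) with qe φ
... | ψ , qψ , φ⇔ψ with ∃-eliminate (neg qψ)
...   | χ , qχ , ∃¬ψ⇔χ = ¬' χ , neg qχ , λ ρ →
  ⇔-trans (∀⇔¬∃¬ λ a → Decidable.map (⇔-sym (φ⇔ψ (a ∷ᵉ ρ))) (QF-dec qψ (a ∷ᵉ ρ)))
          (¬-cong-⇔ (⇔-trans (Σ-⇔ (↠-id ℚ) (¬-cong-⇔ (φ⇔ψ _))) (∃¬ψ⇔χ ρ)))

theorem3p4 : (n : ℕ) (φ : Formula n) →
    Σ (Formula n) (λ ψ → QF ψ × Equivalent φ ψ)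
theorem3p4 n φ = qe φ
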